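{- Let $(G,c)$ be a bicolored graph. Every successful pressing sequence of $(G,c)$ has exactly $\operatorname{rank}(A(G))$ vertices, where the rank is taken over $\mathbb{F}_2$; in particular this number depends only on the bicolored graph.
   Context: A bicolored graph is a pair $(G,c)$ with $G$ a finite simple graph and $c:V(G)\to\{\text{black},\text{white}\}$. The augmented adjacency matrix $A(G)\in\mathbb{F}_2^{n\times n}$ is the adjacency matrix of $G$ with diagonal entry $1$ at black and $0$ at white vertices. Pressing a black vertex $v$ complements the induced subgraph on the closed neighborhood $N^\ast(v)=N(v)\cup\{v\}$ and flips the color of each vertex of $N^\ast(v)$, leaving everything else unchanged. A pressing sequence is a sequence of vertices each of which is black at the moment it is pressed; it is successful if the final graph has no edges and all vertices white. -}

module Defs where

open import Data.Nat using (ℕ; _≤_)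
open import Data.Fin using (Fin; zero; suc; _≟_)
open import Data.Bool using (Bool; true; false; not; _∧_; _∨_; _xor_; if_then_else_)
open import Data.List using (List; []; _∷_; length)
open import Data.Product using (Σ; _×_)
open import Relation.Nullary.Decidable using (⌊_⌋)
open import Relation.Binary.PropositionalEquality using (_≡_)

record BicoloredGraph (n : ℕ) : Set where
  field
    adj    : Fin n → Fin n → Bool
    sym    : ∀ u w → adj u w ≡ adj w u
    irrefl : ∀ u → adj u u ≡ false
    black  : Fin n → Bool

record State (n : ℕ) : Set where
  constructor state
  field
    adj   : Fin n → Fin n → Bool
    black : Fin n → Bool

toState : ∀ {n} → BicoloredGraph n → State n
toState G = state (BicoloredGraph.adj G) (BicoloredGraph.black G)

inClosedNbhd : ∀ {n} → State n → Fin n → Fin n → Bool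
inClosedNbhd S v u = ⌊ u ≟ v ⌋ ∨ State.adj S v u

press : ∀ {n} → Fin n → State n → State n
press v S = state adj′ black′
  where
  adj′ : _ → _ → Bool
  adj′ u w = if inClosedNbhd S v u ∧ inClosedNbhd S v w ∧ not ⌊ u ≟ w ⌋
             then not (State.adj S u w) else State.adj S u w
  black′ : _ → Bool
  black′ u = if inClosedNbhd S v u then not (State.black S u) else State.black S u

data Successful {n : ℕ} : State n → List (Fin n) → Set where
  done : ∀ {S} → (∀ u w → State.adj S u w ≡ false) → (∀ u → State.black S u ≡ false)
       → Successful S []
  step : ∀ {S v s} → State.black S v ≡ true → Successful (press v S) s
       → Successful S (v ∷ s)

-- augmented adjacency matrix over F₂ (Bool with xor as addition, ∧ as product)
augAdj : ∀ {n} → BicoloredGraph n → Fin n → Fin n → Bool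
augAdj G u w = if ⌊ u ≟ w ⌋ then BicoloredGraph.black G u else BicoloredGraph.adj G u w

lincomb : ∀ {n} (k : ℕ) → (Fin k → Bool) → (Fin k → Fin n → Bool) → Fin n → Bool
lincomb ℕ.zero    cs vs j = false
lincomb (ℕ.suc k) cs vs j = (cs zero ∧ vs zero j) xor lincomb k (λ i → cs (suc i)) (λ i → vs (suc i)) j

LinIndep : ∀ {n} (k : ℕ) → (Fin k → Fin n → Bool) → Set
LinIndep k vs = ∀ cs → (∀ j → lincomb k cs vs j ≡ false) → ∀ i → cs i ≡ false

IsRank : ∀ {m n} → (Fin m → Fin n → Bool) → ℕ → Set
IsRank {m} M r =
  Σ (Fin r → Fin m) (λ f → LinIndep r (λ i → M (f i)))
  × (∀ k (f : Fin k → Fin m) → LinIndep k (λ i → M (f i)) → k ≤ r)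

module Submission where

-- Pressing a black vertex v of a bicolored graph is a rank-one update of its
-- augmented adjacency matrix over F₂:  M' = M + r rᵀ,  where r is row v of M
-- (M is symmetric and M_vv = 1, so M' has a zero v-th column).  Hence, by
-- induction along a successful pressing sequence s, the rows of M indexed by
-- s form a basis of the row space of M: the rows of M' indexed by the tail of
-- s form a basis for M' (the final, zero matrix has the empty basis), adding
-- r keeps them independent because r is the only vector with a nonzero v-th
-- entry, and passing from M' back to M only adds multiples of r to each row.
-- The Steinitz bound (k independent vectors in the span of m vectors force
-- k ≤ m) then shows that no family of rows of M is independent with more
-- than |s| members, i.e. |s| is the rank of M.

open import Defs
open import Data.Nat using (ℕ; zero; suc; _≤_; z≤n; s≤s)
open import Data.Nat.Properties using (m≤n⇒m≤1+n)
open import Data.Fin using (Fin; zero; suc; _≟_; punchIn)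
open import Data.Fin.Properties using (any?)
open import Data.Vec.Functional using (tail; insertAt; removeAt) renaming (_∷_ to _◂_)
open import Data.Vec.Functional.Properties using (insertAt-lookup; insertAt-punchIn)
open import Data.Bool using (Bool; true; false; not; _∧_; _xor_; if_then_else_)
open import Data.Bool.Properties
  using (∧-comm; ∧-assoc; ∧-zeroʳ; ∧-idem; ∧-identityʳ; ∧-distribˡ-xor; ∧-distribʳ-xor;
         xor-comm; xor-assoc; xor-same; xor-identityʳ; ¬-not; xor-∧-commutativeRing)
  renaming (_≟_ to _≟ᵇ_)
open import Data.List using (List; []; _∷_; length; lookup)
open import Data.Product using (Σ; _×_; _,_; proj₁; proj₂)
open import Function using (_∘_)
open import Relation.Nullary using (yes; no; contradiction)
open import Relation.Nullary.Decidable using (⌊_⌋)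
open import Relation.Binary.PropositionalEquality
open import Algebra.Bundles using (CommutativeRing; CommutativeMonoid)
open import Algebra.Properties.CommutativeSemigroup
  (CommutativeMonoid.commutativeSemigroup (CommutativeRing.+-commutativeMonoid xor-∧-commutativeRing))
  using (interchange; x∙yz≈y∙xz; x∙yz≈xz∙y)

open ≡-Reasoning

-- F₂-linear combinations.

xor-cancelʳ : ∀ a b → (a xor b) xor b ≡ a
xor-cancelʳ a b = begin
  (a xor b) xor b   ≡⟨ xor-assoc a b b ⟩
  a xor (b xor b)   ≡⟨ cong (a xor_) (xor-same b) ⟩
  a xor false       ≡⟨ xor-identityʳ a ⟩
  a                 ∎

if-not≡xor : ∀ p a → (if p then not a else a) ≡ a xor p
if-not≡xor true  a = sym (xor-comm a true)
if-not≡xor false a = sym (xor-identityʳ a)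

∧-swapʳ : ∀ a b c → (a ∧ b) ∧ c ≡ (a ∧ c) ∧ b
∧-swapʳ a b c = begin
  (a ∧ b) ∧ c   ≡⟨ ∧-assoc a b c ⟩
  a ∧ (b ∧ c)   ≡⟨ cong (a ∧_) (∧-comm b c) ⟩
  a ∧ (c ∧ b)   ≡⟨ sym (∧-assoc a c b) ⟩
  (a ∧ c) ∧ b   ∎

dot : ∀ k → (Fin k → Bool) → (Fin k → Bool) → Bool
dot zero    c a = false
dot (suc k) c a = (c zero ∧ a zero) xor dot k (tail c) (tail a)

dot-zeroˡ : ∀ k (c a : Fin k → Bool) → (∀ i → c i ≡ false) → dot k c a ≡ false
dot-zeroˡ zero    c a c≡0 = refl
dot-zeroˡ (suc k) c a c≡0 rewrite c≡0 zero = dot-zeroˡ k (tail c) (tail a) (c≡0 ∘ suc)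

module _ {n : ℕ} where

  lincomb-cong : ∀ k {c c' : Fin k → Bool} {vs ws : Fin k → Fin n → Bool} x
               → (∀ i → c i ≡ c' i) → (∀ i → vs i x ≡ ws i x)
               → lincomb k c vs x ≡ lincomb k c' ws x
  lincomb-cong zero    x c≡ v≡ = refl
  lincomb-cong (suc k) x c≡ v≡ =
    cong₂ _xor_ (cong₂ _∧_ (c≡ zero) (v≡ zero)) (lincomb-cong k x (c≡ ∘ suc) (v≡ ∘ suc))

  lincomb-zeroᵛ : ∀ k c (vs : Fin k → Fin n → Bool) x → (∀ i → vs i x ≡ false)
                → lincomb k c vs x ≡ false
  lincomb-zeroᵛ zero    c vs x vs≡0 = refl
  lincomb-zeroᵛ (suc k) c vs x vs≡0 rewrite vs≡0 zero | lincomb-zeroᵛ k (tail c) (tail vs) x (vs≡0 ∘ suc)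
    = trans (xor-identityʳ (c zero ∧ false)) (∧-zeroʳ (c zero))

  lincomb-xorᵛ : ∀ k c (vs ws : Fin k → Fin n → Bool) x
               → lincomb k c (λ i y → vs i y xor ws i y) x ≡ lincomb k c vs x xor lincomb k c ws x
  lincomb-xorᵛ zero    c vs ws x = refl
  lincomb-xorᵛ (suc k) c vs ws x = begin
    (c zero ∧ (vs zero x xor ws zero x)) xor lincomb k (tail c) _ x
      ≡⟨ cong₂ _xor_ (∧-distribˡ-xor (c zero) (vs zero x) (ws zero x))
                     (lincomb-xorᵛ k (tail c) (tail vs) (tail ws) x) ⟩
    ((c zero ∧ vs zero x) xor (c zero ∧ ws zero x))
      xor (lincomb k (tail c) (tail vs) x xor lincomb k (tail c) (tail ws) x)
      ≡⟨ interchange (c zero ∧ vs zero x) (c zero ∧ ws zero x) (lincomb k (tail c) (tail vs) x) _ ⟩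
    lincomb (suc k) c vs x xor lincomb (suc k) c ws x ∎

  lincomb-xorᶜ : ∀ k (c d : Fin k → Bool) (vs : Fin k → Fin n → Bool) x
               → lincomb k (λ i → c i xor d i) vs x ≡ lincomb k c vs x xor lincomb k d vs x
  lincomb-xorᶜ zero    c d vs x = refl
  lincomb-xorᶜ (suc k) c d vs x = begin
    ((c zero xor d zero) ∧ vs zero x) xor lincomb k _ (tail vs) x
      ≡⟨ cong₂ _xor_ (∧-distribʳ-xor (vs zero x) (c zero) (d zero))
                     (lincomb-xorᶜ k (tail c) (tail d) (tail vs) x) ⟩
    ((c zero ∧ vs zero x) xor (d zero ∧ vs zero x))
      xor (lincomb k (tail c) (tail vs) x xor lincomb k (tail d) (tail vs) x)
      ≡⟨ interchange (c zero ∧ vs zero x) (d zero ∧ vs zero x) (lincomb k (tail c) (tail vs) x) _ ⟩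
    lincomb (suc k) c vs x xor lincomb (suc k) d vs x ∎

  lincomb-∧ᶜ : ∀ k (c : Fin k → Bool) z (vs : Fin k → Fin n → Bool) x
             → lincomb k (λ i → c i ∧ z) vs x ≡ lincomb k c vs x ∧ z
  lincomb-∧ᶜ zero    c z vs x = refl
  lincomb-∧ᶜ (suc k) c z vs x = begin
    ((c zero ∧ z) ∧ vs zero x) xor lincomb k (λ i → c (suc i) ∧ z) (tail vs) x
      ≡⟨ cong₂ _xor_ (∧-swapʳ (c zero) z (vs zero x)) (lincomb-∧ᶜ k (tail c) z (tail vs) x) ⟩
    ((c zero ∧ vs zero x) ∧ z) xor (lincomb k (tail c) (tail vs) x ∧ z)
      ≡⟨ sym (∧-distribʳ-xor z (c zero ∧ vs zero x) (lincomb k (tail c) (tail vs) x)) ⟩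
    lincomb (suc k) c vs x ∧ z ∎

  lincomb-scaled : ∀ k c (a : Fin k → Bool) (r : Fin n → Bool) x
                 → lincomb k c (λ i y → a i ∧ r y) x ≡ dot k c a ∧ r x
  lincomb-scaled zero    c a r x = refl
  lincomb-scaled (suc k) c a r x = begin
    (c zero ∧ (a zero ∧ r x)) xor lincomb k (tail c) (λ i y → a (suc i) ∧ r y) x
      ≡⟨ cong₂ _xor_ (sym (∧-assoc (c zero) (a zero) (r x))) (lincomb-scaled k (tail c) (tail a) r x) ⟩
    ((c zero ∧ a zero) ∧ r x) xor (dot k (tail c) (tail a) ∧ r x)
      ≡⟨ sym (∧-distribʳ-xor (r x) (c zero ∧ a zero) (dot k (tail c) (tail a))) ⟩
    dot (suc k) c a ∧ r x ∎

  lincomb-removeAt : ∀ k c (vs : Fin (suc k) → Fin n → Bool) (j : Fin (suc k)) x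
                   → lincomb (suc k) c vs x ≡ (c j ∧ vs j x) xor lincomb k (removeAt c j) (removeAt vs j) x
  lincomb-removeAt k       c vs zero    x = refl
  lincomb-removeAt (suc k) c vs (suc j) x =
    trans (cong ((c zero ∧ vs zero x) xor_) (lincomb-removeAt k (tail c) (tail vs) j x))
          (x∙yz≈y∙xz (c zero ∧ vs zero x) (c (suc j) ∧ vs (suc j) x) _)

-- Spans, independence and the Steinitz bound.

InSpan : ∀ {m n} → (Fin m → Fin n → Bool) → (Fin n → Bool) → Set
InSpan {m} us w = Σ (Fin m → Bool) λ c → ∀ x → w x ≡ lincomb m c us x

LinIndep-resp : ∀ {k n} {vs ws : Fin k → Fin n → Bool}
              → (∀ i x → vs i x ≡ ws i x) → LinIndep k vs → LinIndep k ws
LinIndep-resp {k} eq ind cs comb≡0 =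
  ind cs (λ x → trans (lincomb-cong k x (λ _ → refl) (λ i → eq i x)) (comb≡0 x))

LinIndep-eliminate : ∀ {k n} (ws : Fin (suc k) → Fin n → Bool) (j : Fin (suc k)) (a : Fin k → Bool)
                   → LinIndep (suc k) ws
                   → LinIndep k (λ i x → ws (punchIn j i) x xor (a i ∧ ws j x))
LinIndep-eliminate {k} ws j a ind cs comb≡0 i =
  trans (sym (insertAt-punchIn cs j d i)) (ind cs⁺ comb⁺≡0 (punchIn j i))
  where
  -- a relation among the new vectors is the relation cs⁺ among the old ones
  d : Bool
  d = dot k cs a
  cs⁺ : Fin (suc k) → Bool
  cs⁺ = insertAt cs j d
  comb⁺≡0 : ∀ x → lincomb (suc k) cs⁺ ws x ≡ false
  comb⁺≡0 x = begin
    lincomb (suc k) cs⁺ ws x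
      ≡⟨ lincomb-removeAt k cs⁺ ws j x ⟩
    (cs⁺ j ∧ ws j x) xor lincomb k (removeAt cs⁺ j) (removeAt ws j) x
      ≡⟨ cong (λ b → (b ∧ ws j x) xor lincomb k (removeAt cs⁺ j) (removeAt ws j) x)
              (insertAt-lookup cs j d) ⟩
    (d ∧ ws j x) xor lincomb k (removeAt cs⁺ j) (removeAt ws j) x
      ≡⟨ cong ((d ∧ ws j x) xor_) (lincomb-cong k x (insertAt-punchIn cs j d) (λ _ → refl)) ⟩
    (d ∧ ws j x) xor lincomb k cs (removeAt ws j) x
      ≡⟨ xor-comm (d ∧ ws j x) _ ⟩
    lincomb k cs (removeAt ws j) x xor (d ∧ ws j x)
      ≡⟨ cong (lincomb k cs (removeAt ws j) x xor_) (sym (lincomb-scaled k cs a (ws j) x)) ⟩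
    lincomb k cs (removeAt ws j) x xor lincomb k cs (λ i y → a i ∧ ws j y) x
      ≡⟨ sym (lincomb-xorᵛ k cs (removeAt ws j) _ x) ⟩
    lincomb k cs (λ i y → ws (punchIn j i) y xor (a i ∧ ws j y)) x
      ≡⟨ comb≡0 x ⟩
    false ∎

lincomb-eliminate : ∀ {m n} (us : Fin (suc m) → Fin n → Bool) (C D : Fin (suc m) → Bool)
                  → D zero ≡ true → ∀ x
                  → lincomb (suc m) C us x xor (C zero ∧ lincomb (suc m) D us x)
                    ≡ lincomb m (λ l → C (suc l) xor (D (suc l) ∧ C zero)) (tail us) x
lincomb-eliminate {m} us C D D₀≡1 x = begin
  (cu xor P) xor (C zero ∧ ((D zero ∧ u) xor Q))
    ≡⟨ cong (λ b → (cu xor P) xor (C zero ∧ ((b ∧ u) xor Q))) D₀≡1 ⟩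
  (cu xor P) xor (C zero ∧ (u xor Q))
    ≡⟨ cong ((cu xor P) xor_) (∧-distribˡ-xor (C zero) u Q) ⟩
  (cu xor P) xor (cu xor (C zero ∧ Q))
    ≡⟨ interchange cu P cu (C zero ∧ Q) ⟩
  (cu xor cu) xor (P xor (C zero ∧ Q))
    ≡⟨ cong₂ _xor_ (xor-same cu) (cong (P xor_) (∧-comm (C zero) Q)) ⟩
  P xor (Q ∧ C zero)
    ≡⟨ cong (P xor_) (sym (lincomb-∧ᶜ m (tail D) (C zero) (tail us) x)) ⟩
  P xor lincomb m (λ l → D (suc l) ∧ C zero) (tail us) x
    ≡⟨ sym (lincomb-xorᶜ m (tail C) (λ l → D (suc l) ∧ C zero) (tail us) x) ⟩
  lincomb m (λ l → C (suc l) xor (D (suc l) ∧ C zero)) (tail us) x ∎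
  where
  u cu P Q : Bool
  u  = us zero x
  cu = C zero ∧ u
  P  = lincomb m (tail C) (tail us) x
  Q  = lincomb m (tail D) (tail us) x

-- By induction on m: if some wⱼ uses u₀, it eliminates u₀ from the other
-- vectors (one vector fewer on both sides); otherwise u₀ is superfluous.
independent-in-span-≤ : ∀ {n} m k (us : Fin m → Fin n → Bool) (ws : Fin k → Fin n → Bool)
                      → (∀ j → InSpan us (ws j)) → LinIndep k ws → k ≤ m
independent-in-span-≤ m       zero    us ws spans ind = z≤n
independent-in-span-≤ zero    (suc k) us ws spans ind =
  contradiction (ind (λ _ → true) all-vanish zero) λ ()
  where
  all-vanish : ∀ x → lincomb (suc k) (λ _ → true) ws x ≡ false
  all-vanish x = lincomb-zeroᵛ (suc k) (λ _ → true) ws x (λ j → proj₂ (spans j) x)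
independent-in-span-≤ {n} (suc m) (suc k) us ws spans ind
  with any? (λ j → proj₁ (spans j) zero ≟ᵇ true)
... | no none = m≤n⇒m≤1+n (independent-in-span-≤ m (suc k) (tail us) ws spans′ ind)
  where
  spans′ : ∀ j → InSpan (tail us) (ws j)
  spans′ j = tail C , λ x →
    trans (proj₂ (spans j) x)
          (cong (λ b → (b ∧ us zero x) xor lincomb m (tail C) (tail us) x)
                (¬-not (λ C₀≡1 → none (j , C₀≡1))))
    where
    C : Fin (suc m) → Bool
    C = proj₁ (spans j)
... | yes (j , pivot) =
  s≤s (independent-in-span-≤ m k (tail us) ws′ spans′ (LinIndep-eliminate ws j a ind))
  where
  C : Fin (suc k) → Fin (suc m) → Bool
  C i = proj₁ (spans i)
  a : Fin k → Bool
  a i = C (punchIn j i) zero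
  ws′ : Fin k → Fin n → Bool
  ws′ i x = ws (punchIn j i) x xor (a i ∧ ws j x)
  spans′ : ∀ i → InSpan (tail us) (ws′ i)
  spans′ i = _ , λ x →
    trans (cong₂ (λ w w′ → w xor (a i ∧ w′)) (proj₂ (spans (punchIn j i)) x) (proj₂ (spans j) x))
          (lincomb-eliminate us (C (punchIn j i)) (C j) pivot x)

LinIndep-cons : ∀ {k n} (r : Fin n → Bool) (ws : Fin k → Fin n → Bool) (x₀ : Fin n)
              → r x₀ ≡ true → (∀ i → ws i x₀ ≡ false) → LinIndep k ws → LinIndep (suc k) (r ◂ ws)
LinIndep-cons {k} r ws x₀ r≡1 ws≡0 ind cs comb≡0 = λ { zero → head≡0 ; (suc i) → ind (tail cs) tail≡0 i }
  where
  head≡0 : cs zero ≡ false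
  head≡0 = begin
    cs zero                                               ≡⟨ sym (∧-identityʳ (cs zero)) ⟩
    cs zero ∧ true                                        ≡⟨ cong (cs zero ∧_) (sym r≡1) ⟩
    cs zero ∧ r x₀                                        ≡⟨ sym (xor-identityʳ _) ⟩
    (cs zero ∧ r x₀) xor false                            ≡⟨ cong ((cs zero ∧ r x₀) xor_)
                                                               (sym (lincomb-zeroᵛ k (tail cs) ws x₀ ws≡0)) ⟩
    (cs zero ∧ r x₀) xor lincomb k (tail cs) ws x₀        ≡⟨ comb≡0 x₀ ⟩
    false                                                 ∎
  tail≡0 : ∀ x → lincomb k (tail cs) ws x ≡ false
  tail≡0 x = trans (cong (λ b → (b ∧ r x) xor lincomb k (tail cs) ws x) (sym head≡0)) (comb≡0 x)

lincomb-shear : ∀ {k n} b c (r : Fin n → Bool) (ws : Fin k → Fin n → Bool) (a : Fin k → Bool) x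
              → lincomb (suc k) (b ◂ c) (r ◂ (λ i y → ws i y xor (a i ∧ r y))) x
                ≡ lincomb (suc k) ((b xor dot k c a) ◂ c) (r ◂ ws) x
lincomb-shear {k} b c r ws a x = begin
  (b ∧ r x) xor lincomb k c (λ i y → ws i y xor (a i ∧ r y)) x
    ≡⟨ cong ((b ∧ r x) xor_) (lincomb-xorᵛ k c ws (λ i y → a i ∧ r y) x) ⟩
  (b ∧ r x) xor (L xor lincomb k c (λ i y → a i ∧ r y) x)
    ≡⟨ cong (λ z → (b ∧ r x) xor (L xor z)) (lincomb-scaled k c a r x) ⟩
  (b ∧ r x) xor (L xor (D ∧ r x))
    ≡⟨ x∙yz≈xz∙y (b ∧ r x) L (D ∧ r x) ⟩
  ((b ∧ r x) xor (D ∧ r x)) xor L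
    ≡⟨ cong (_xor L) (sym (∧-distribʳ-xor (r x) b D)) ⟩
  ((b xor D) ∧ r x) xor L ∎
  where
  L D : Bool
  L = lincomb k c ws x
  D = dot k c a

LinIndep-shear : ∀ {k n} (r : Fin n → Bool) (ws : Fin k → Fin n → Bool) (a : Fin k → Bool)
               → LinIndep (suc k) (r ◂ ws) → LinIndep (suc k) (r ◂ (λ i y → ws i y xor (a i ∧ r y)))
LinIndep-shear {k} r ws a ind cs comb≡0 = λ { zero → head≡0 ; (suc i) → cs′≡0 (suc i) }
  where
  cs′ : Fin (suc k) → Bool
  cs′ = (cs zero xor dot k (tail cs) a) ◂ tail cs
  cs′≡0 : ∀ i → cs′ i ≡ false
  cs′≡0 = ind cs′ (λ x → trans (sym (lincomb-shear (cs zero) (tail cs) r ws a x)) (comb≡0 x))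
  head≡0 : cs zero ≡ false
  head≡0 = begin
    cs zero                                ≡⟨ sym (xor-identityʳ (cs zero)) ⟩
    cs zero xor false                      ≡⟨ cong (cs zero xor_) (sym (dot-zeroˡ k (tail cs) a (cs′≡0 ∘ suc))) ⟩
    cs zero xor dot k (tail cs) a          ≡⟨ cs′≡0 zero ⟩
    false                                  ∎

-- Pressing as a rank-one update of the augmented matrix.

matrix : ∀ {n} → State n → Fin n → Fin n → Bool
matrix S u w = if ⌊ u ≟ w ⌋ then State.black S u else State.adj S u w

SymmetricMatrix : ∀ {n} → State n → Set
SymmetricMatrix S = ∀ u w → matrix S u w ≡ matrix S w u

⌊≟⌋-refl : ∀ {n} (u : Fin n) → ⌊ u ≟ u ⌋ ≡ true
⌊≟⌋-refl u with u ≟ u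
... | yes _   = refl
... | no u≢u = contradiction refl u≢u

⌊≟⌋-≢ : ∀ {n} {u w : Fin n} → u ≢ w → ⌊ u ≟ w ⌋ ≡ false
⌊≟⌋-≢ {u = u} {w} u≢w with u ≟ w
... | yes u≡w = contradiction u≡w u≢w
... | no _    = refl

matrix-diag : ∀ {n} (S : State n) u → matrix S u u ≡ State.black S u
matrix-diag S u rewrite ⌊≟⌋-refl u = refl

graph-symmetric : ∀ {n} (G : BicoloredGraph n) → SymmetricMatrix (toState G)
graph-symmetric G u w with u ≟ w
... | yes refl = sym (matrix-diag (toState G) u)
... | no u≢w rewrite ⌊≟⌋-≢ (u≢w ∘ sym) = BicoloredGraph.sym G u w

matrix-zero : ∀ {n} (S : State n) → (∀ u w → State.adj S u w ≡ false) → (∀ u → State.black S u ≡ false)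
            → ∀ u w → matrix S u w ≡ false
matrix-zero S adj≡0 black≡0 u w with ⌊ u ≟ w ⌋
... | true  = black≡0 u
... | false = adj≡0 u w

closedNbhd≡row : ∀ {n} (S : State n) {v} → State.black S v ≡ true
               → ∀ u → inClosedNbhd S v u ≡ matrix S v u
closedNbhd≡row S {v} black u with v ≟ u
... | yes refl rewrite ⌊≟⌋-refl v = sym black
... | no v≢u rewrite ⌊≟⌋-≢ (v≢u ∘ sym) = refl

press-matrix : ∀ {n} (S : State n) {v} → State.black S v ≡ true → ∀ u w
             → matrix (press v S) u w ≡ matrix S u w xor (matrix S v u ∧ matrix S v w)
press-matrix S {v} black u w with u ≟ w
... | yes refl = begin
  (if N u then not b else b)   ≡⟨ if-not≡xor (N u) b ⟩
  b xor N u                    ≡⟨ cong (b xor_) (closedNbhd≡row S black u) ⟩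
  b xor matrix S v u           ≡⟨ cong (b xor_) (sym (∧-idem (matrix S v u))) ⟩
  b xor (matrix S v u ∧ matrix S v u) ∎
  where
  N : Fin _ → Bool
  N = inClosedNbhd S v
  b : Bool
  b = State.black S u
... | no _ = begin
  (if N u ∧ N w ∧ true then not e else e)   ≡⟨ if-not≡xor (N u ∧ N w ∧ true) e ⟩
  e xor (N u ∧ N w ∧ true)                  ≡⟨ cong (λ p → e xor (N u ∧ p)) (∧-identityʳ (N w)) ⟩
  e xor (N u ∧ N w)                         ≡⟨ cong₂ (λ p q → e xor (p ∧ q))
                                                     (closedNbhd≡row S black u) (closedNbhd≡row S black w) ⟩
  e xor (matrix S v u ∧ matrix S v w)       ∎
  where
  N : Fin _ → Bool
  N = inClosedNbhd S v
  e : Bool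
  e = State.adj S u w

module _ {n} (S : State n) {v : Fin n} (black : State.black S v ≡ true) where

  press-symmetric : SymmetricMatrix S → SymmetricMatrix (press v S)
  press-symmetric symm u w = begin
    matrix (press v S) u w                          ≡⟨ press-matrix S black u w ⟩
    matrix S u w xor (matrix S v u ∧ matrix S v w)  ≡⟨ cong₂ _xor_ (symm u w) (∧-comm (matrix S v u) _) ⟩
    matrix S w u xor (matrix S v w ∧ matrix S v u)  ≡⟨ sym (press-matrix S black w u) ⟩
    matrix (press v S) w u                          ∎

  -- As M is symmetric with M_vv = 1, the update clears column v.
  press-clears-column : SymmetricMatrix S → ∀ u → matrix (press v S) u v ≡ false
  press-clears-column symm u = begin
    matrix (press v S) u v                          ≡⟨ press-matrix S black u v ⟩
    matrix S u v xor (matrix S v u ∧ matrix S v v)  ≡⟨ cong₂ (λ p q → matrix S u v xor (p ∧ q))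
                                                              (symm v u) (trans (matrix-diag S v) black) ⟩
    matrix S u v xor (matrix S u v ∧ true)          ≡⟨ cong (matrix S u v xor_) (∧-identityʳ _) ⟩
    matrix S u v xor matrix S u v                   ≡⟨ xor-same (matrix S u v) ⟩
    false                                           ∎

  press-row : ∀ u x → matrix S u x ≡ matrix (press v S) u x xor (matrix S v u ∧ matrix S v x)
  press-row u x = sym (trans (cong (_xor (matrix S v u ∧ matrix S v x)) (press-matrix S black u x))
                             (xor-cancelʳ (matrix S u x) _))

-- Successful pressing sequences index row bases.

rows : ∀ {n} → State n → (s : List (Fin n)) → Fin (length s) → Fin n → Bool
rows S s i = matrix S (lookup s i)

RowBasis : ∀ {n} → State n → List (Fin n) → Set
RowBasis S s = LinIndep (length s) (rows S s) × (∀ u → InSpan (rows S s) (matrix S u))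

-- A row basis of press v S, listed by s, extends to the row basis of S
-- listed by v ∷ s: the rows of S are r = row v followed by the rows of
-- press v S sheared by r, and r is the only one not vanishing in column v.
RowBasis-press : ∀ {n} (S : State n) {v} (s : List (Fin n)) → State.black S v ≡ true
               → SymmetricMatrix S → RowBasis (press v S) s → RowBasis S (v ∷ s)
RowBasis-press S {v} s black symm (independent′ , spanning′) = independent , spanning
  where
  L : ℕ
  L = length s
  r : Fin _ → Bool
  r = matrix S v
  a : Fin L → Bool
  a i = r (lookup s i)
  sheared : Fin L → Fin _ → Bool
  sheared i y = rows (press v S) s i y xor (a i ∧ r y)

  rows≡ : ∀ i x → (r ◂ sheared) i x ≡ rows S (v ∷ s) i x
  rows≡ zero    x = refl
  rows≡ (suc i) x = sym (press-row S black (lookup s i) x)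

  independent : LinIndep (suc L) (rows S (v ∷ s))
  independent =
    LinIndep-resp rows≡
      (LinIndep-shear r (rows (press v S) s) a
        (LinIndep-cons r (rows (press v S) s) v (trans (matrix-diag S v) black)
          (λ i → press-clears-column S black symm (lookup s i)) independent′))

  spanning : ∀ u → InSpan (rows S (v ∷ s)) (matrix S u)
  spanning u = ((r u xor D) ◂ c) , λ x → begin
    matrix S u x
      ≡⟨ press-row S black u x ⟩
    matrix (press v S) u x xor (r u ∧ r x)
      ≡⟨ cong (_xor (r u ∧ r x)) (proj₂ (spanning′ u) x) ⟩
    lincomb L c (rows (press v S) s) x xor (r u ∧ r x)
      ≡⟨ xor-comm _ (r u ∧ r x) ⟩
    lincomb (suc L) (r u ◂ c) (r ◂ rows (press v S) s) x
      ≡⟨ cong (λ b → lincomb (suc L) (b ◂ c) (r ◂ rows (press v S) s) x) (sym (xor-cancelʳ (r u) D)) ⟩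
    lincomb (suc L) (((r u xor D) xor D) ◂ c) (r ◂ rows (press v S) s) x
      ≡⟨ sym (lincomb-shear (r u xor D) c r (rows (press v S) s) a x) ⟩
    lincomb (suc L) ((r u xor D) ◂ c) (r ◂ sheared) x
      ≡⟨ lincomb-cong (suc L) {c = (r u xor D) ◂ c} {vs = r ◂ sheared} {ws = rows S (v ∷ s)} x
                      (λ _ → refl) (λ i → rows≡ i x) ⟩
    lincomb (suc L) ((r u xor D) ◂ c) (rows S (v ∷ s)) x ∎
    where
    c : Fin L → Bool
    c = proj₁ (spanning′ u)
    D : Bool
    D = dot L c a

successful⇒RowBasis : ∀ {n} (S : State n) (s : List (Fin n))
                    → SymmetricMatrix S → Successful S s → RowBasis S s
successful⇒RowBasis S [] symm (done adj≡0 black≡0) =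
  (λ cs _ ()) , λ u → (λ ()) , matrix-zero S adj≡0 black≡0 u
successful⇒RowBasis S (v ∷ s) symm (step black success) =
  RowBasis-press S s black symm
    (successful⇒RowBasis (press v S) s (press-symmetric S black symm) success)

corollary1 : ∀ {n} (G : BicoloredGraph n) (s : List (Fin n))
           → Successful (toState G) s → IsRank (augAdj G) (length s)
corollary1 G s success = (lookup s , proj₁ basis) , maximal
  where
  basis : RowBasis (toState G) s
  basis = successful⇒RowBasis (toState G) s (graph-symmetric G) success
  maximal : ∀ k f → LinIndep k (λ i → augAdj G (f i)) → k ≤ length s
  maximal k f = independent-in-span-≤ (length s) k (rows (toState G) s) (λ i → augAdj G (f i))
                                      (λ j → proj₂ basis (f j))
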